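{- Let $k\ge 0$, let $V_u^k=\{v_1<v_2<\dots<v_m\}$ in lexicographic order, and let $i\in[k+6]$. The following maps are order-preserving (with respect to inclusion on the domain): (i) $\varphi:\mathcal{P}_3^k\to\{a_1>a_2>\dots>a_{k+6}>a\}$ defined by $\varphi^{ -1}(a_{i'})=\bigsqcup_{j\in I_{i'}}\mathcal{P}_{i',j}^k$ for $i'\in[k+6]$ and $\varphi^{ -1}(a)=\mathcal{P}_2^k$; (ii) $\varphi_i:\bigsqcup_{j\in I_i}\mathcal{P}_{i,j}^k\to\{c_{i+2}>c_{i+3}>\dots>c_{k+6}>c_1>\dots>c_{i-3}>c_{i-2}\}$ defined by $\varphi_i^{ -1}(c_j)=\mathcal{P}_{i,j}^k$; (iii) for $j\in I_i$, $\varphi_{i,j}:\mathcal{P}_{i,j}^k\to\{b_{v_1}>b_{v_2}>\dots>b_{v_m}\}$ defined by $\varphi_{i,j}^{ -1}(b_{v_s})=\{\sigma\in\mathcal{P}_{i,j}^k : v_s\in\sigma,\ v_t\notin\sigma \text{ for all } t<s\}$.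
   Context: For a positive integer $n$, $[n]=\{1,\dots,n\}$; arithmetic on $[k+6]$ is mod $k+6$ with representatives in $[k+6]$. $KG_{3,k}$ has as vertices the $3$-element subsets of $[k+6]$, adjacent iff disjoint; vertices are written as increasing triples and ordered lexicographically. A vertex $v$ is stable if there is no $t\in[k+6]$ with $\{t,t+1\}\subseteq v$ (mod $k+6$), unstable otherwise; $V_u^k$ is the set of unstable vertices. $S_{3,k}$ has the same vertices as $KG_{3,k}$ and the edges of $KG_{3,k}$ with at least one stable endpoint. For a graph $G$, $\mathcal{N}(G)$ is the neighborhood complex (simplices: nonempty vertex sets with a common neighbor in $G$). For a set $\sigma$ of vertices, $C_\sigma=[k+6]\setminus\bigcup_{\alpha\in\sigma}\alpha$. Let $X_1^k=\mathcal{N}(S_{3,k})$, $X_3^k=\mathcal{N}(KG_{3,k})$, $X_2^k=X_1^k\sqcup\{\sigma\in X_3^k\setminus X_1^k : |C_\sigma|=4\}$, and $\mathcal{P}_i^k$ the face poset of $X_i^k$. For $s\in[k+6]$, $I_s=[k+6]\setminus\{s-1,s,s+1\}$. For $i\in[k+6]$, $j\in I_i$: $\mathcal{P}_{i,j}^k=\{\sigma\in\mathcal{P}_3^k\setminus\mathcal{P}_2^k : C_\sigma=\{i,i+1,j\}\}$. The indices $c_{i+2},\dots,c_{i-2}$ in (ii) run over $I_i$ in cyclic order. -}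

module Defs where

open import Data.Nat as ℕ using (ℕ; _+_; _∸_; _%_)
open import Data.Nat.DivMod using (_mod_)
open import Data.Fin as Fin using (Fin; toℕ)
open import Data.Bool using (Bool; true)
open import Data.List using (List; length)
open import Data.List.Membership.Propositional using (_∈_)
open import Data.List.Relation.Unary.Unique.Propositional using (Unique)
open import Data.Product using (Σ; ∃; _×_)
open import Data.Sum using (_⊎_)
open import Data.Unit using (⊤)
open import Data.Empty using (⊥)
open import Relation.Nullary using (¬_)
open import Relation.Binary.PropositionalEquality using (_≡_; _≢_)
open import Function.Bundles using (_⇔_)

-- The ground set [k+6] is modelled by Fin (6 + k); the Fin element t stands
-- for the integer t+1 ∈ [k+6] (so the natural order is preserved).
N : ℕ → ℕ
N k = 6 + k

El : ℕ → Set
El k = Fin (N k)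

next : {k : ℕ} → El k → El k
next {k} x = ℕ.suc (toℕ x) mod N k

prev : {k : ℕ} → El k → El k
prev {k} x = (toℕ x + (N k ∸ 1)) mod N k

-- vertices of KG_{3,k}: 3-subsets written as increasing triples
record Vertex (k : ℕ) : Set where
  constructor vtx
  field
    a b c : El k
    a<b : a Fin.< b
    b<c : b Fin.< c
open Vertex public

_∈v_ : {k : ℕ} → El k → Vertex k → Set
x ∈v v = x ≡ a v ⊎ x ≡ b v ⊎ x ≡ c v

Disjoint : {k : ℕ} → Vertex k → Vertex k → Set
Disjoint v w = ∀ x → x ∈v v → ¬ (x ∈v w)

Unstable : {k : ℕ} → Vertex k → Set
Unstable v = ∃ λ t → t ∈v v × next t ∈v v

Stable : {k : ℕ} → Vertex k → Set
Stable v = ¬ Unstable v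

KGAdj : {k : ℕ} → Vertex k → Vertex k → Set
KGAdj v w = Disjoint v w

SAdj : {k : ℕ} → Vertex k → Vertex k → Set
SAdj v w = Disjoint v w × (Stable v ⊎ Stable w)

VSet : ℕ → Set
VSet k = Vertex k → Bool

_∈s_ : {k : ℕ} → Vertex k → VSet k → Set
v ∈s σ = σ v ≡ true

_⊆_ : {k : ℕ} → VSet k → VSet k → Set
σ ⊆ τ = ∀ v → v ∈s σ → v ∈s τ

InNbhdComplex : {k : ℕ} → (Vertex k → Vertex k → Set) → VSet k → Set
InNbhdComplex Adj σ = (∃ λ v → v ∈s σ) × (∃ λ w → ∀ α → α ∈s σ → Adj α w)

InX1 : {k : ℕ} → VSet k → Set
InX1 = InNbhdComplex SAdj

InX3 : {k : ℕ} → VSet k → Set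
InX3 = InNbhdComplex KGAdj

InC : {k : ℕ} → VSet k → El k → Set
InC σ x = ∀ α → α ∈s σ → ¬ (x ∈v α)

HasCard : {k : ℕ} → (El k → Set) → ℕ → Set
HasCard {k} P m = Σ (List (El k)) λ l → length l ≡ m × Unique l × (∀ x → P x ⇔ x ∈ l)

InX2 : {k : ℕ} → VSet k → Set
InX2 σ = InX1 σ ⊎ (InX3 σ × ¬ InX1 σ × HasCard (InC σ) 4)

InI : {k : ℕ} → El k → El k → Set
InI s j = j ≢ prev s × j ≢ s × j ≢ next s

InP : {k : ℕ} → El k → El k → VSet k → Set
InP i j σ = InX3 σ × ¬ InX2 σ × (∀ x → InC σ x ⇔ (x ≡ i ⊎ x ≡ next i ⊎ x ≡ j))

data ChainA (k : ℕ) : Set where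
  a₀ : ChainA k
  aᵢ : El k → ChainA k

_≤A_ : {k : ℕ} → ChainA k → ChainA k → Set
a₀ ≤A _ = ⊤
aᵢ t ≤A a₀ = ⊥
aᵢ t ≤A aᵢ s = toℕ s ℕ.≤ toℕ t

φFib : {k : ℕ} → VSet k → ChainA k → Set
φFib σ a₀ = InX2 σ
φFib σ (aᵢ i') = ∃ λ j → InI i' j × InP i' j σ

-- (ii) the chain c_{i+2} > c_{i+3} > ... > c_{i-2}: c_j is ranked by the
-- cyclic distance from i to j (smaller distance = larger element)
cdist : {k : ℕ} → El k → El k → ℕ
cdist {k} i j = (toℕ j + N k ∸ toℕ i) % N k

_≤C[_]_ : {k : ℕ} → El k → El k → El k → Set
j ≤C[ i ] j' = cdist i j' ℕ.≤ cdist i j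

_<lex_ : {k : ℕ} → Vertex k → Vertex k → Set
v <lex w = (a v Fin.< a w)
         ⊎ (a v ≡ a w × b v Fin.< b w)
         ⊎ (a v ≡ a w × b v ≡ b w × c v Fin.< c w)

_≡v_ : {k : ℕ} → Vertex k → Vertex k → Set
v ≡v w = a v ≡ a w × b v ≡ b w × c v ≡ c w

_≤lex_ : {k : ℕ} → Vertex k → Vertex k → Set
v ≤lex w = v ≡v w ⊎ v <lex w

BFib : {k : ℕ} → VSet k → Vertex k → Set
BFib σ v = Unstable v × v ∈s σ × (∀ w → Unstable w → w <lex v → ¬ (w ∈s σ))

module Submission where

-- Everything rests on the complement C_σ of a face σ of X_3.  Shrinking σ
-- enlarges C_σ, so inclusions σ ⊆ τ become inclusions C_τ ⊆ C_σ.  If σ is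
-- not in X_1 then C_σ contains no stable 3-set (it would be a stable common
-- neighbour), and a short case analysis on the cycle [k+6] (k+6 ≥ 6) shows
-- that such a set has at most four elements, and that a 3-subset containing
-- an adjacent pair can be written {i, i+1, j} with j ∈ I_i.  Hence every
-- σ ∈ X_3 \ X_1 has |C_σ| ∈ {3,4}: it lies in X_2 or in exactly one P_{i,j},
-- which makes φ total.  Monotonicity of φ and φ_i reduces to the facts that
-- a 3-set cannot contain a 4-set (pigeonhole) and that {s,s+1,j'} ⊆ {t,t+1,j}
-- forces s = t and j' = j.  For φ_{i,j} we pick the lexicographically least
-- unstable vertex of σ (one exists since σ ∉ X_1), and monotonicity is then
-- immediate from minimality.

open import Defs
open import Data.Nat as ℕ using (ℕ; zero; suc; _+_; _*_; _∸_; _%_; z≤n; s≤s)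
import Data.Nat.Properties as ℕP
open import Data.Nat.DivMod
  using (%-distribˡ-+; m%n%n≡m%n; m<n⇒m%n≡m; m≤n⇒[n∸m]%m≡n%m; [m+n]%n≡m%n; n%n≡0)
open import Data.Fin as Fin using (Fin; toℕ)
import Data.Fin.Properties as FP
open import Data.Product using (Σ; ∃; ∃₂; _×_; _,_; proj₁; proj₂)
open import Data.Sum using (_⊎_; inj₁; inj₂)
open import Data.Empty using (⊥; ⊥-elim)
open import Data.Unit using (tt)
open import Data.Bool using (true) renaming (_≟_ to _≟B_)
open import Data.List using (List; []; _∷_; length; filter; allFin; _++_)
open import Data.List.Membership.Propositional using (_∈_)
open import Data.List.Membership.Propositional.Properties
  using (∈-∃++; ∈-++⁻; ∈-++⁺ˡ; ∈-++⁺ʳ; ∈-filter⁺; ∈-filter⁻; ∈-allFin)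
open import Data.List.Relation.Unary.Any using (here; there)
open import Data.List.Relation.Unary.All as All using ([]; _∷_)
open import Data.List.Relation.Unary.AllPairs as AllPairs using (AllPairs; []; _∷_)
import Data.List.Relation.Unary.AllPairs.Properties as AllPairsP
open import Data.List.Properties using (length-++-sucʳ)
open import Function.Base using (_∘_)
open import Function.Bundles using (Equivalence; _⇔_; mk⇔)
open import Function.Construct.Composition using (_⇔-∘_)
open import Relation.Nullary using (¬_; Dec; yes; no)
open import Relation.Nullary.Decidable
  using (_×-dec_; _⊎-dec_; _→-dec_; ¬?; map′; decidable-stable)
open import Relation.Binary.PropositionalEquality
open import Relation.Binary.Definitions using (tri<; tri≈; tri>)
open Equivalence using (to; from)

unique-length-≤ : {A : Set} (l S : List A) → AllPairs _≢_ l →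
                  (∀ x → x ∈ l → x ∈ S) → length l ℕ.≤ length S
unique-length-≤ [] S _ _ = z≤n
unique-length-≤ (x ∷ l) S (x∉l ∷ u) l⊆S with ∈-∃++ (l⊆S x (here refl))
... | ys , zs , refl =
  subst (suc (length l) ℕ.≤_) (sym (length-++-sucʳ ys x zs))
        (s≤s (unique-length-≤ l (ys ++ zs) u l⊆S∖x))
  where
  l⊆S∖x : ∀ y → y ∈ l → y ∈ ys ++ zs
  l⊆S∖x y y∈l with ∈-++⁻ ys (l⊆S y (there y∈l))
  ... | inj₁ p = ∈-++⁺ˡ p
  ... | inj₂ (here refl) = ⊥-elim (All.lookup x∉l y∈l refl)
  ... | inj₂ (there p) = ∈-++⁺ʳ ys p

card-≤ : ∀ {k m} {P : El k → Set} (S : List (El k)) →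
         HasCard P m → (∀ x → P x → x ∈ S) → m ℕ.≤ length S
card-≤ S (l , refl , u , P⇔l) P⊆S =
  unique-length-≤ l S u (λ x x∈l → P⊆S x (from (P⇔l x) x∈l))

module _ {k : ℕ} where

  In₃ : El k → El k → El k → El k → Set
  In₃ x y z e = e ≡ x ⊎ e ≡ y ⊎ e ≡ z

  swap₁₂ : ∀ {x y z e} → In₃ x y z e → In₃ y x z e
  swap₁₂ (inj₁ p) = inj₂ (inj₁ p)
  swap₁₂ (inj₂ (inj₁ p)) = inj₁ p
  swap₁₂ (inj₂ (inj₂ p)) = inj₂ (inj₂ p)

  swap₂₃ : ∀ {x y z e} → In₃ x y z e → In₃ x z y e
  swap₂₃ (inj₁ p) = inj₁ p
  swap₂₃ (inj₂ (inj₁ p)) = inj₂ (inj₂ p)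
  swap₂₃ (inj₂ (inj₂ p)) = inj₂ (inj₁ p)

  ∈-triple : ∀ {x y z e} → e ∈ (x ∷ y ∷ z ∷ []) ⇔ In₃ x y z e
  ∈-triple = mk⇔ to′ from′
    where
    to′ : ∀ {x y z e} → e ∈ (x ∷ y ∷ z ∷ []) → In₃ x y z e
    to′ (here p) = inj₁ p
    to′ (there (here p)) = inj₂ (inj₁ p)
    to′ (there (there (here p))) = inj₂ (inj₂ p)
    from′ : ∀ {x y z e} → In₃ x y z e → e ∈ (x ∷ y ∷ z ∷ [])
    from′ (inj₁ p) = here p
    from′ (inj₂ (inj₁ p)) = there (here p)
    from′ (inj₂ (inj₂ p)) = there (there (here p))

  no-card4-in-triple : ∀ {P : El k → Set} {x y z} →
                       (∀ e → P e → In₃ x y z e) → ¬ HasCard P 4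
  no-card4-in-triple P⊆xyz card
    with card-≤ (_ ∷ _ ∷ _ ∷ []) card (λ e Pe → from ∈-triple (P⊆xyz e Pe))
  ... | s≤s (s≤s (s≤s ()))

%-absorbʳ : ∀ b a d .{{_ : ℕ.NonZero d}} → (b + a % d) % d ≡ (b + a) % d
%-absorbʳ b a d = begin
  (b + a % d) % d          ≡⟨ %-distribˡ-+ b (a % d) d ⟩
  (b % d + a % d % d) % d  ≡⟨ cong (λ r → (b % d + r) % d) (m%n%n≡m%n a d) ⟩
  (b % d + a % d) % d      ≡⟨ %-distribˡ-+ b a d ⟨
  (b + a) % d              ∎
  where open ≡-Reasoning

shift-≢ : ∀ {m x n} .{{_ : ℕ.NonZero n}} →
          0 ℕ.< m → m ℕ.< n → x ℕ.< n → (m + x) % n ≢ x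
shift-≢ {m} {x} {n} 0<m m<n x<n eq with m + x ℕ.<? n
... | yes fits = ℕP.<⇒≢ (ℕP.m<n+m x 0<m) (sym (trans (sym (m<n⇒m%n≡m fits)) eq))
... | no ¬fits = ℕP.<⇒≢ m<n (sym n≡m)
  where
  open ≡-Reasoning
  n≤m+x : n ℕ.≤ m + x
  n≤m+x = ℕP.≮⇒≥ ¬fits
  reduced : m + x ∸ n ≡ x
  reduced = begin
    m + x ∸ n            ≡⟨ m<n⇒m%n≡m (ℕP.m<n+o⇒m∸n<o (m + x) n (ℕP.+-mono-< m<n x<n)) ⟨
    (m + x ∸ n) % n      ≡⟨ m≤n⇒[n∸m]%m≡n%m n≤m+x ⟩
    (m + x) % n          ≡⟨ eq ⟩
    x                    ∎
  n≡m : n ≡ m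
  n≡m = ℕP.+-cancelʳ-≡ x n m (begin
    n + x                ≡⟨ ℕP.+-comm n x ⟩
    x + n                ≡⟨ cong (_+ n) reduced ⟨
    m + x ∸ n + n        ≡⟨ ℕP.m∸n+n≡m n≤m+x ⟩
    m + x                ∎)

module _ {k : ℕ} where
  open ≡-Reasoning

  toℕ-next : (x : El k) → toℕ (next x) ≡ suc (toℕ x) % N k
  toℕ-next x = FP.toℕ-fromℕ< _

  toℕ-prev : (x : El k) → toℕ (prev x) ≡ (toℕ x + (5 + k)) % N k
  toℕ-prev x = FP.toℕ-fromℕ< _

  next-cases : (x : El k) → (toℕ x ℕ.< 5 + k × toℕ (next x) ≡ suc (toℕ x))
                          ⊎ (toℕ x ≡ 5 + k × toℕ (next x) ≡ 0)
  next-cases x with ℕP.m≤n⇒m<n∨m≡n (FP.toℕ≤pred[n] x)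
  ... | inj₁ x<top = inj₁ (x<top , trans (toℕ-next x) (m<n⇒m%n≡m (s≤s x<top)))
  ... | inj₂ x≡top = inj₂ (x≡top , (begin
    toℕ (next x)        ≡⟨ toℕ-next x ⟩
    suc (toℕ x) % N k   ≡⟨ cong (λ m → suc m % N k) x≡top ⟩
    N k % N k           ≡⟨ n%n≡0 (N k) ⟩
    0                   ∎))

  prev-next : (x : El k) → prev (next x) ≡ x
  prev-next x = FP.toℕ-injective (begin
    toℕ (prev (next x))                  ≡⟨ toℕ-prev (next x) ⟩
    (toℕ (next x) + (5 + k)) % N k       ≡⟨ cong (λ m → (m + (5 + k)) % N k) (toℕ-next x) ⟩
    (suc (toℕ x) % N k + (5 + k)) % N k  ≡⟨ cong (_% N k) (ℕP.+-comm (suc (toℕ x) % N k) (5 + k)) ⟩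
    ((5 + k) + suc (toℕ x) % N k) % N k  ≡⟨ %-absorbʳ (5 + k) (suc (toℕ x)) (N k) ⟩
    ((5 + k) + suc (toℕ x)) % N k        ≡⟨ cong (_% N k) (ℕP.+-comm (5 + k) (suc (toℕ x))) ⟩
    (suc (toℕ x) + (5 + k)) % N k        ≡⟨ cong (_% N k) (ℕP.+-suc (toℕ x) (5 + k)) ⟨
    (toℕ x + N k) % N k                  ≡⟨ [m+n]%n≡m%n (toℕ x) (N k) ⟩
    toℕ x % N k                          ≡⟨ m<n⇒m%n≡m (FP.toℕ<n x) ⟩
    toℕ x                                ∎)

  next-prev : (x : El k) → next (prev x) ≡ x
  next-prev x = FP.toℕ-injective (begin
    toℕ (next (prev x))                  ≡⟨ toℕ-next (prev x) ⟩
    (1 + toℕ (prev x)) % N k             ≡⟨ cong (λ m → (1 + m) % N k) (toℕ-prev x) ⟩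
    (1 + (toℕ x + (5 + k)) % N k) % N k  ≡⟨ %-absorbʳ 1 (toℕ x + (5 + k)) (N k) ⟩
    suc (toℕ x + (5 + k)) % N k          ≡⟨ cong (_% N k) (ℕP.+-suc (toℕ x) (5 + k)) ⟨
    (toℕ x + N k) % N k                  ≡⟨ [m+n]%n≡m%n (toℕ x) (N k) ⟩
    toℕ x % N k                          ≡⟨ m<n⇒m%n≡m (FP.toℕ<n x) ⟩
    toℕ x                                ∎)

  next-injective : {x y : El k} → next x ≡ next y → x ≡ y
  next-injective {x} {y} e = begin
    x               ≡⟨ prev-next x ⟨
    prev (next x)   ≡⟨ cong prev e ⟩
    prev (next y)   ≡⟨ prev-next y ⟩
    y               ∎

  ≡prev⇒next≡ : {i j : El k} → j ≡ prev i → next j ≡ i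
  ≡prev⇒next≡ {i} refl = next-prev i

  next≡⇒≡prev : {i j : El k} → next j ≡ i → j ≡ prev i
  next≡⇒≡prev {j = j} refl = sym (prev-next j)

  next^ : ℕ → El k → El k
  next^ zero x = x
  next^ (suc m) x = next (next^ m x)

  toℕ-next^ : (m : ℕ) (x : El k) → toℕ (next^ m x) ≡ (m + toℕ x) % N k
  toℕ-next^ zero x = sym (m<n⇒m%n≡m (FP.toℕ<n x))
  toℕ-next^ (suc m) x = begin
    toℕ (next (next^ m x))         ≡⟨ toℕ-next (next^ m x) ⟩
    (1 + toℕ (next^ m x)) % N k    ≡⟨ cong (λ r → (1 + r) % N k) (toℕ-next^ m x) ⟩
    (1 + (m + toℕ x) % N k) % N k  ≡⟨ %-absorbʳ 1 (m + toℕ x) (N k) ⟩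
    (suc m + toℕ x) % N k          ∎

  next^-≢ : (m : ℕ) → 0 ℕ.< m → m ℕ.< N k → (x : El k) → next^ m x ≢ x
  next^-≢ m 0<m m<N x e =
    shift-≢ 0<m m<N (FP.toℕ<n x) (trans (sym (toℕ-next^ m x)) (cong toℕ e))

  next≢ : (x : El k) → next x ≢ x
  next≢ = next^-≢ 1 (s≤s z≤n) (ℕP.m≤m+n 2 (4 + k))

  next²≢ : (x : El k) → next (next x) ≢ x
  next²≢ = next^-≢ 2 (s≤s z≤n) (ℕP.m≤m+n 3 (3 + k))

  next³≢ : (x : El k) → next (next (next x)) ≢ x
  next³≢ = next^-≢ 3 (s≤s z≤n) (ℕP.m≤m+n 4 (2 + k))

  above-zero : {x y : El k} → x Fin.< y → toℕ y ≢ 0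
  above-zero {x} x<y y≡0 = ℕP.n≮0 (subst (toℕ x ℕ.<_) y≡0 x<y)

  below-top : {x y : El k} → x Fin.< y → toℕ x ≢ 5 + k
  below-top {y = y} x<y x≡top = ℕP.<-irrefl x≡top (ℕP.<-≤-trans x<y (FP.toℕ≤pred[n] y))

  ascending-step : {p q : El k} → p Fin.< q → next p ≡ q → toℕ q ≡ suc (toℕ p)
  ascending-step {p} p<q refl with next-cases p
  ... | inj₁ (_ , step) = step
  ... | inj₂ (_ , wrap) = ⊥-elim (above-zero p<q wrap)

  descending-step : {p q : El k} → p Fin.< q → next q ≡ p → toℕ q ≡ 5 + k × toℕ p ≡ 0
  descending-step {q = q} p<q refl with next-cases q
  ... | inj₁ (_ , step) = ⊥-elim (ℕP.<-asym p<q (subst (toℕ q ℕ.<_) (sym step) (ℕP.n<1+n _)))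
  ... | inj₂ wrap = wrap

module _ {k : ℕ} where

  vtx-≡ : (v w : Vertex k) → a v ≡ a w → b v ≡ b w → c v ≡ c w → v ≡ w
  vtx-≡ (vtx x y z p q) (vtx .x .y .z p′ q′) refl refl refl =
    cong₂ (vtx x y z) (FP.<-irrelevant p p′) (FP.<-irrelevant q q′)

  b≢a : (v : Vertex k) → b v ≢ a v
  b≢a v = ≢-sym (FP.<⇒≢ (a<b v))

  c≢b : (v : Vertex k) → c v ≢ b v
  c≢b v = ≢-sym (FP.<⇒≢ (b<c v))

  c≢a : (v : Vertex k) → c v ≢ a v
  c≢a v = ≢-sym (FP.<⇒≢ (FP.<-trans (a<b v) (b<c v)))

  -- The decision procedures below are exhaustive searches; they are kept
  -- abstract so that the type checker never unfolds them.
  abstract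
    all-vertices? : {P : Vertex k → Set} → (∀ v → Dec (P v)) → Dec (∀ v → P v)
    all-vertices? {P} P? =
      map′ (λ h v → h (a v) (b v) (c v) (a<b v) (b<c v)) (λ h x y z p q → h (vtx x y z p q))
           (FP.all? λ x → FP.all? λ y → FP.all? λ z → triple? x y z)
      where
      triple? : ∀ x y z → Dec ((p : x Fin.< y) (q : y Fin.< z) → P (vtx x y z p q))
      triple? x y z with x FP.<? y | y FP.<? z
      ... | no x≮y | _ = yes (λ p → ⊥-elim (x≮y p))
      ... | yes _ | no y≮z = yes (λ _ q → ⊥-elim (y≮z q))
      ... | yes p | yes q with P? (vtx x y z p q)
      ...   | yes h = yes (λ p′ q′ → subst P (vtx-≡ _ _ refl refl refl) h)
      ...   | no ¬h = no (λ h → ¬h (h p q))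

    any-vertex? : {P : Vertex k → Set} → (∀ v → Dec (P v)) → Dec (∃ P)
    any-vertex? {P} P? =
      map′ (λ (x , y , z , p , q , h) → vtx x y z p q , h)
           (λ (v , h) → a v , b v , c v , a<b v , b<c v , h)
           (FP.any? λ x → FP.any? λ y → FP.any? λ z → triple? x y z)
      where
      triple? : ∀ x y z → Dec (Σ (x Fin.< y) λ p → Σ (y Fin.< z) λ q → P (vtx x y z p q))
      triple? x y z with x FP.<? y | y FP.<? z
      ... | no x≮y | _ = no (λ (p , _) → x≮y p)
      ... | yes _ | no y≮z = no (λ (_ , q , _) → y≮z q)
      ... | yes p | yes q with P? (vtx x y z p q)
      ...   | yes h = yes (p , q , h)
      ...   | no ¬h = no (λ (p′ , q′ , h) → ¬h (subst P (vtx-≡ _ _ refl refl refl) h))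

    _∈v?_ : (x : El k) (v : Vertex k) → Dec (x ∈v v)
    x ∈v? v = (x FP.≟ a v) ⊎-dec ((x FP.≟ b v) ⊎-dec (x FP.≟ c v))

    unstable? : (v : Vertex k) → Dec (Unstable v)
    unstable? v = FP.any? (λ t → (t ∈v? v) ×-dec (next t ∈v? v))

    disjoint? : (v w : Vertex k) → Dec (Disjoint v w)
    disjoint? v w = FP.all? (λ x → (x ∈v? v) →-dec ¬? (x ∈v? w))

    sadj? : (v w : Vertex k) → Dec (SAdj v w)
    sadj? v w = disjoint? v w ×-dec (¬? (unstable? v) ⊎-dec ¬? (unstable? w))

    inC? : (σ : VSet k) (x : El k) → Dec (InC σ x)
    inC? σ x = all-vertices? (λ α → (σ α ≟B true) →-dec ¬? (x ∈v? α))

    inX1? : (σ : VSet k) → InX3 σ → Dec (InX1 σ)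
    inX1? σ (nonempty , _) = map′ (nonempty ,_) proj₂
      (any-vertex? (λ w → all-vertices? (λ α → (σ α ≟B true) →-dec sadj? α w)))

no-room : ∀ {x y z} → x ℕ.< y → y ℕ.< z → suc x ≢ z
no-room x<y y<z refl = ℕP.<-irrefl refl (ℕP.<-≤-trans x<y (ℕP.≤-pred y<z))

module _ {k : ℕ} where

  Spread : El k → El k → El k → Set
  Spread x y z = suc (toℕ x) ≢ toℕ y × suc (toℕ y) ≢ toℕ z × ¬ (toℕ x ≡ 0 × toℕ z ≡ 5 + k)

  spread⇒stable : (v : Vertex k) → Spread (a v) (b v) (c v) → Stable v
  spread⇒stable v (gap₁ , gap₂ , ¬wrap) (_ , t∈v , t+1∈v) = adjacent t∈v t+1∈v
    where
    a<c : a v Fin.< c v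
    a<c = FP.<-trans (a<b v) (b<c v)
    adjacent : ∀ {t} → t ∈v v → next t ∈v v → ⊥
    adjacent (inj₁ refl) (inj₁ e) = next≢ _ e
    adjacent (inj₁ refl) (inj₂ (inj₁ e)) = gap₁ (sym (ascending-step (a<b v) e))
    adjacent (inj₁ refl) (inj₂ (inj₂ e)) = no-room (a<b v) (b<c v) (sym (ascending-step a<c e))
    adjacent (inj₂ (inj₁ refl)) (inj₁ e) =
      below-top (b<c v) (proj₁ (descending-step (a<b v) e))
    adjacent (inj₂ (inj₁ refl)) (inj₂ (inj₁ e)) = next≢ _ e
    adjacent (inj₂ (inj₁ refl)) (inj₂ (inj₂ e)) = gap₂ (sym (ascending-step (b<c v) e))
    adjacent (inj₂ (inj₂ refl)) (inj₁ e) =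
      ¬wrap (proj₂ (descending-step a<c e) , proj₁ (descending-step a<c e))
    adjacent (inj₂ (inj₂ refl)) (inj₂ (inj₁ e)) =
      above-zero (a<b v) (proj₂ (descending-step (b<c v) e))
    adjacent (inj₂ (inj₂ refl)) (inj₂ (inj₂ e)) = next≢ _ e

  StableFree : (El k → Set) → Set
  StableFree P = ∀ v → (∀ x → x ∈v v → P x) → Unstable v

  SpreadFree : (El k → Set) → Set
  SpreadFree P = ∀ {x y z} → x Fin.< y → y Fin.< z → P x → P y → P z → ¬ Spread x y z

  stable-free⇒spread-free : {P : El k → Set} → StableFree P → SpreadFree P
  stable-free⇒spread-free {P} free {x} {y} {z} x<y y<z Px Py Pz spread =
    spread⇒stable (vtx x y z x<y y<z) spread (free (vtx x y z x<y y<z) within)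
    where
    within : ∀ e → In₃ x y z e → P e
    within e (inj₁ refl) = Px
    within e (inj₂ (inj₁ refl)) = Py
    within e (inj₂ (inj₂ refl)) = Pz

  -- A stable-free subset of the cycle of length k+6 ≥ 6 has at most four
  -- elements: among five ascending ones a spread triple can always be chosen.
  five-points-impossible : {P : El k → Set} → SpreadFree P →
    ∀ {y₁ y₂ y₃ y₄ y₅} → y₁ Fin.< y₂ → y₂ Fin.< y₃ → y₃ Fin.< y₄ → y₄ Fin.< y₅ →
    P y₁ → P y₂ → P y₃ → P y₄ → P y₅ → ⊥
  five-points-impossible spread-free {y₁} {y₂} {y₃} {y₄} {y₅} p₁₂ p₂₃ p₃₄ p₄₅ P₁ P₂ P₃ P₄ P₅
    with (toℕ y₁ ℕ.≟ 0) ×-dec (toℕ y₅ ℕ.≟ 5 + k)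
  ... | no ¬wrap =
    spread-free (FP.<-trans p₁₂ p₂₃) (FP.<-trans p₃₄ p₄₅) P₁ P₃ P₅
      (no-room p₁₂ p₂₃ , no-room p₃₄ p₄₅ , ¬wrap)
  ... | yes (y₁≡0 , y₅≡top) with suc (toℕ y₄) ℕ.≟ toℕ y₅
  ...   | no gap₄₅ =
    spread-free (FP.<-trans p₂₃ p₃₄) p₄₅ P₂ P₄ P₅
      (no-room p₂₃ p₃₄ , gap₄₅ , above-zero p₁₂ ∘ proj₁)
  ...   | yes step₄₅ with suc (toℕ y₃) ℕ.≟ toℕ y₄
  ...     | no gap₃₄ =
    spread-free (FP.<-trans p₁₂ p₂₃) p₃₄ P₁ P₃ P₄
      (no-room p₁₂ p₂₃ , gap₃₄ , below-top p₄₅ ∘ proj₂)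
  ...     | yes step₃₄ with suc (toℕ y₂) ℕ.≟ toℕ y₃
  ...       | no gap₂₃ =
    spread-free p₂₃ (FP.<-trans p₃₄ p₄₅) P₂ P₃ P₅
      (gap₂₃ , (λ e → ℕP.<-irrefl (trans (sym step₃₄) e) p₄₅) , above-zero p₁₂ ∘ proj₁)
  ...       | yes step₂₃ =
    spread-free p₁₂ (FP.<-trans p₂₃ p₃₄) P₁ P₂ P₄
      (y₂≢1 , no-room p₂₃ p₃₄ , below-top p₄₅ ∘ proj₂)
    where
    open ≡-Reasoning
    top≢4 : 5 + k ≢ 4
    top≢4 ()
    -- here y₁ = 0 and y₂, y₃, y₄, y₅ are consecutive ending at k+5
    y₂≢1 : suc (toℕ y₁) ≢ toℕ y₂
    y₂≢1 e = top≢4 (begin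
      5 + k               ≡⟨ y₅≡top ⟨
      toℕ y₅              ≡⟨ step₄₅ ⟨
      1 + toℕ y₄          ≡⟨ cong (1 +_) step₃₄ ⟨
      2 + toℕ y₃          ≡⟨ cong (2 +_) step₂₃ ⟨
      3 + toℕ y₂          ≡⟨ cong (3 +_) e ⟨
      4 + toℕ y₁          ≡⟨ cong (4 +_) y₁≡0 ⟩
      4                   ∎)

  third-element : (v : Vertex k) {t u : El k} → t ∈v v → u ∈v v → t ≢ u →
    ∃ λ r → r ≢ t × r ≢ u × (∀ e → e ∈v v ⇔ In₃ t u r e)
  third-element v (inj₁ refl) (inj₁ refl) t≢u = ⊥-elim (t≢u refl)
  third-element v (inj₁ refl) (inj₂ (inj₁ refl)) _ =
    c v , c≢a v , c≢b v , λ _ → mk⇔ (λ h → h) (λ h → h)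
  third-element v (inj₁ refl) (inj₂ (inj₂ refl)) _ =
    b v , b≢a v , ≢-sym (c≢b v) , λ _ → mk⇔ swap₂₃ swap₂₃
  third-element v (inj₂ (inj₁ refl)) (inj₁ refl) _ =
    c v , c≢b v , c≢a v , λ _ → mk⇔ swap₁₂ swap₁₂
  third-element v (inj₂ (inj₁ refl)) (inj₂ (inj₁ refl)) t≢u = ⊥-elim (t≢u refl)
  third-element v (inj₂ (inj₁ refl)) (inj₂ (inj₂ refl)) _ =
    a v , ≢-sym (b≢a v) , ≢-sym (c≢a v) ,
    λ _ → mk⇔ (λ h → swap₂₃ (swap₁₂ h)) (λ h → swap₁₂ (swap₂₃ h))
  third-element v (inj₂ (inj₂ refl)) (inj₁ refl) _ =
    b v , ≢-sym (c≢b v) , b≢a v ,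
    λ _ → mk⇔ (λ h → swap₁₂ (swap₂₃ h)) (λ h → swap₂₃ (swap₁₂ h))
  third-element v (inj₂ (inj₂ refl)) (inj₂ (inj₁ refl)) _ =
    a v , ≢-sym (c≢a v) , ≢-sym (b≢a v) ,
    λ _ → mk⇔ (λ h → swap₁₂ (swap₂₃ (swap₁₂ h))) (λ h → swap₁₂ (swap₂₃ (swap₁₂ h)))
  third-element v (inj₂ (inj₂ refl)) (inj₂ (inj₂ refl)) t≢u = ⊥-elim (t≢u refl)

  consecutive-in-I : (r : El k) → InI r (next (next r))
  consecutive-in-I r =
    (λ e → next³≢ r (≡prev⇒next≡ e)) , next²≢ r , (λ e → next≢ r (next-injective e))

  rotate-back : (r e : El k) → In₃ (next r) (next (next r)) r e ⇔ In₃ r (next r) (next (next r)) e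
  rotate-back _ _ = mk⇔ (λ h → swap₁₂ (swap₂₃ h)) (λ h → swap₂₃ (swap₁₂ h))

  -- An unstable vertex has the form {i, i+1, j} with j ∈ I_i: take an
  -- adjacent pair {t, t+1} ⊆ v; if the third element r is t-1 use i = r.
  unstable-shape : (v : Vertex k) → Unstable v →
    ∃₂ λ i j → InI i j × (∀ e → e ∈v v ⇔ In₃ i (next i) j e)
  unstable-shape v (t , t∈v , t+1∈v) with third-element v t∈v t+1∈v (≢-sym (next≢ t))
  ... | r , r≢t , r≢t+1 , v≈ with r FP.≟ prev t
  ...   | no r≢prev = t , r , (r≢prev , r≢t , r≢t+1) , v≈
  ...   | yes r≡prev with ≡prev⇒next≡ {i = t} r≡prev
  ...     | refl = r , next (next r) , consecutive-in-I r , λ e → rotate-back r e ⇔-∘ v≈ e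

  consecutive-pair-unique : {t j s j′ : El k} → InI t j → InI s j′ →
    (∀ x → In₃ s (next s) j′ x → In₃ t (next t) j x) → s ≡ t
  consecutive-pair-unique {t} {j} {s} {j′} (j≢t-1 , _ , _) (j′≢s-1 , j′≢s , j′≢s+1) ⊆t
    with ⊆t s (inj₁ refl) | ⊆t (next s) (inj₂ (inj₁ refl))
  ... | inj₁ s≡t | _ = s≡t
  ... | _ | inj₂ (inj₁ s+1≡t+1) = next-injective s+1≡t+1
  ... | inj₂ (inj₁ s≡t+1) | inj₁ s+1≡t =
    ⊥-elim (next²≢ t (trans (cong next (sym s≡t+1)) s+1≡t))
  ... | inj₂ (inj₂ s≡j) | inj₁ s+1≡t = ⊥-elim (j≢t-1 (trans (sym s≡j) (next≡⇒≡prev s+1≡t)))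
  ... | inj₂ (inj₂ s≡j) | inj₂ (inj₂ s+1≡j) = ⊥-elim (next≢ s (trans s+1≡j (sym s≡j)))
  ... | inj₂ (inj₁ s≡t+1) | inj₂ (inj₂ s+1≡j) with ⊆t j′ (inj₂ (inj₂ refl))
  ...   | inj₁ j′≡t = ⊥-elim (j′≢s-1 (trans j′≡t (next≡⇒≡prev (sym s≡t+1))))
  ...   | inj₂ (inj₁ j′≡t+1) = ⊥-elim (j′≢s (trans j′≡t+1 (sym s≡t+1)))
  ...   | inj₂ (inj₂ j′≡j) = ⊥-elim (j′≢s+1 (trans j′≡j (sym s+1≡j)))

leading-digit-< : ∀ {A A′ B B′ n} → A ℕ.< A′ → B ℕ.< n → A * n + B ℕ.< A′ * n + B′
leading-digit-< {A} {A′} {B} {B′} {n} A<A′ B<n = begin-strict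
  A * n + B      <⟨ ℕP.+-monoʳ-< (A * n) B<n ⟩
  A * n + n      ≡⟨ ℕP.+-comm (A * n) n ⟩
  suc A * n      ≤⟨ ℕP.*-monoˡ-≤ n A<A′ ⟩
  A′ * n         ≤⟨ ℕP.m≤m+n (A′ * n) B′ ⟩
  A′ * n + B′    ∎
  where open ℕP.≤-Reasoning

module _ {k : ℕ} where

  -- The base-(k+6) number with digits a, b, c; it is strictly monotone for
  -- the lexicographic order, which is therefore well founded.
  code : Vertex k → ℕ
  code v = (toℕ (a v) * N k + toℕ (b v)) * N k + toℕ (c v)

  code-mono : {w v : Vertex k} → w <lex v → code w ℕ.< code v
  code-mono {w} {v} (inj₁ a<a′) =
    leading-digit-< (leading-digit-< a<a′ (FP.toℕ<n (b w))) (FP.toℕ<n (c w))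
  code-mono {w} {v} (inj₂ (inj₁ (refl , b<b′))) =
    leading-digit-< (ℕP.+-monoʳ-< (toℕ (a w) * N k) b<b′) (FP.toℕ<n (c w))
  code-mono {w} {v} (inj₂ (inj₂ (refl , refl , c<c′))) =
    ℕP.+-monoʳ-< ((toℕ (a w) * N k + toℕ (b w)) * N k) c<c′

  _<lex?_ : (w v : Vertex k) → Dec (w <lex v)
  w <lex? v = (a w FP.<? a v)
    ⊎-dec ((a w FP.≟ a v) ×-dec (b w FP.<? b v))
    ⊎-dec ((a w FP.≟ a v) ×-dec (b w FP.≟ b v) ×-dec (c w FP.<? c v))

  ¬<lex⇒≥lex : (v w : Vertex k) → ¬ (v <lex w) → w ≤lex v
  ¬<lex⇒≥lex v w v≮w with FP.<-cmp (a v) (a w)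
  ... | tri< a<a′ _ _ = ⊥-elim (v≮w (inj₁ a<a′))
  ... | tri> _ _ a>a′ = inj₂ (inj₁ a>a′)
  ... | tri≈ _ a≡a′ _ with FP.<-cmp (b v) (b w)
  ...   | tri< b<b′ _ _ = ⊥-elim (v≮w (inj₂ (inj₁ (a≡a′ , b<b′))))
  ...   | tri> _ _ b>b′ = inj₂ (inj₂ (inj₁ (sym a≡a′ , b>b′)))
  ...   | tri≈ _ b≡b′ _ with FP.<-cmp (c v) (c w)
  ...     | tri< c<c′ _ _ = ⊥-elim (v≮w (inj₂ (inj₂ (a≡a′ , b≡b′ , c<c′))))
  ...     | tri> _ _ c>c′ = inj₂ (inj₂ (inj₂ (sym a≡a′ , sym b≡b′ , c>c′)))
  ...     | tri≈ _ c≡c′ _ = inj₁ (sym a≡a′ , sym b≡b′ , sym c≡c′)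

  -- A decidable predicate with a witness has a lexicographically least one:
  -- descend while a smaller witness exists; code bounds the descent.
  lex-least : (P : Vertex k → Set) → (∀ v → Dec (P v)) → {v : Vertex k} → P v →
              ∃ λ m → P m × (∀ w → P w → ¬ w <lex m)
  lex-least P P? {v} Pv = descend (suc (code v)) v ℕP.≤-refl Pv
    where
    descend : (fuel : ℕ) (v : Vertex k) → code v ℕ.< fuel → P v →
              ∃ λ m → P m × (∀ w → P w → ¬ w <lex m)
    descend (suc fuel) v code<fuel Pv with any-vertex? (λ w → P? w ×-dec (w <lex? v))
    ... | yes (w , Pw , w<v) =
      descend fuel w (ℕP.<-≤-trans (code-mono {w} {v} w<v) (ℕP.≤-pred code<fuel)) Pw
    ... | no none = v , Pv , λ w Pw w<v → none (w , Pw , w<v)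

module _ {k : ℕ} where

  complement-antitone : {σ τ : VSet k} → σ ⊆ τ → ∀ x → InC τ x → InC σ x
  complement-antitone σ⊆τ x x∈Cτ α α∈σ = x∈Cτ α (σ⊆τ α α∈σ)

  X1-downward : {σ τ : VSet k} → σ ⊆ τ → ∃ (_∈s σ) → InX1 τ → InX1 σ
  X1-downward σ⊆τ nonempty (_ , w , adj) = nonempty , w , λ α α∈σ → adj α (σ⊆τ α α∈σ)

  all-stable⇒X1 : {σ : VSet k} → InX3 σ → (∀ α → α ∈s σ → Stable α) → InX1 σ
  all-stable⇒X1 (nonempty , w , adj) stable =
    nonempty , w , λ α α∈σ → adj α α∈σ , inj₁ (stable α α∈σ)

  neighbour-in-complement : {σ : VSet k} {w : Vertex k} →
    (∀ α → α ∈s σ → KGAdj α w) → ∀ x → x ∈v w → InC σ x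
  neighbour-in-complement adj x x∈w α α∈σ x∈α = adj α α∈σ x x∈α x∈w

  stable-in-complement⇒X1 : {σ : VSet k} → ∃ (_∈s σ) → (v : Vertex k) →
    (∀ x → x ∈v v → InC σ x) → Stable v → InX1 σ
  stable-in-complement⇒X1 nonempty v v⊆C stable =
    nonempty , v , λ α α∈σ → (λ x x∈α x∈v → v⊆C x x∈v α α∈σ x∈α) , inj₂ stable

  complement-stable-free : {σ : VSet k} → ∃ (_∈s σ) → ¬ InX1 σ → StableFree (InC σ)
  complement-stable-free nonempty ¬x1 v v⊆C =
    decidable-stable (unstable? v) (¬x1 ∘ stable-in-complement⇒X1 nonempty v v⊆C)

  complement-list : VSet k → List (El k)
  complement-list σ = filter (inC? σ) (allFin (N k))

  complement-list-sorted : (σ : VSet k) → AllPairs Fin._<_ (complement-list σ)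
  complement-list-sorted σ = AllPairsP.filter⁺ (inC? σ) (AllPairsP.tabulate⁺-< (λ x<y → x<y))

  complement-list-complete : (σ : VSet k) → ∀ x → InC σ x ⇔ x ∈ complement-list σ
  complement-list-complete σ x =
    mk⇔ (∈-filter⁺ (inC? σ) (∈-allFin x)) (proj₂ ∘ ∈-filter⁻ (inC? σ))

module Classification {k : ℕ} {σ : VSet k} (x3 : InX3 σ) (¬x1 : ¬ InX1 σ) where

  stable-free : StableFree (InC σ)
  stable-free = complement-stable-free (proj₁ x3) ¬x1

  spread-free : SpreadFree (InC σ)
  spread-free = stable-free⇒spread-free stable-free

  -- The three entries of a common neighbour lie in C_σ, so |C_σ| ≥ 3.
  at-least-three : (l : List (El k)) → (∀ x → InC σ x ⇔ x ∈ l) → 3 ℕ.≤ length l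
  at-least-three l C⇔l =
    unique-length-≤ (a w ∷ b w ∷ c w ∷ []) l
      ((≢-sym (b≢a w) ∷ ≢-sym (c≢a w) ∷ []) ∷ (≢-sym (c≢b w) ∷ []) ∷ [] ∷ [])
      (λ x x∈w → to (C⇔l x) (neighbour-in-complement {w = w} adj x (to ∈-triple x∈w)))
    where
    w : Vertex k
    w = proj₁ (proj₂ x3)
    adj : ∀ α → α ∈s σ → KGAdj α w
    adj = proj₂ (proj₂ x3)

  triple-complement⇒P : {i j : El k} → InI i j → (∀ e → InC σ e ⇔ In₃ i (next i) j e) →
                        φFib σ (aᵢ i)
  triple-complement⇒P {i} {j} j∈I C≈ = j , j∈I , x3 , ¬x2 , C≈
    where
    ¬x2 : ¬ InX2 σ
    ¬x2 (inj₁ x1) = ¬x1 x1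
    ¬x2 (inj₂ (_ , _ , card4)) = no-card4-in-triple (λ e → to (C≈ e)) card4

  classify-triple : (v : Vertex k) → (∀ e → InC σ e ⇔ e ∈v v) → Σ (ChainA k) (φFib σ)
  classify-triple v C≈v =
    let i , j , j∈I , v≈ = unstable-shape v (stable-free v (λ e → from (C≈v e)))
    in aᵢ i , triple-complement⇒P j∈I (λ e → v≈ e ⇔-∘ C≈v e)

  classify-sorted : (l : List (El k)) → AllPairs Fin._<_ l → (∀ x → InC σ x ⇔ x ∈ l) →
                    Σ (ChainA k) (φFib σ)
  classify-sorted [] _ C⇔l with at-least-three [] C⇔l
  ... | ()
  classify-sorted (_ ∷ []) _ C⇔l with at-least-three _ C⇔l
  ... | s≤s ()
  classify-sorted (_ ∷ _ ∷ []) _ C⇔l with at-least-three _ C⇔l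
  ... | s≤s (s≤s ())
  classify-sorted (x ∷ y ∷ z ∷ []) ((x<y ∷ _) ∷ (y<z ∷ []) ∷ [] ∷ []) C⇔l =
    classify-triple (vtx x y z x<y y<z) (λ e → ∈-triple ⇔-∘ C⇔l e)
  classify-sorted l@(_ ∷ _ ∷ _ ∷ _ ∷ []) sorted C⇔l =
    a₀ , inj₂ (x3 , ¬x1 , l , refl , AllPairs.map FP.<⇒≢ sorted , C⇔l)
  classify-sorted l@(_ ∷ _ ∷ _ ∷ _ ∷ _ ∷ _)
    ((p₁₂ ∷ _) ∷ (p₂₃ ∷ _) ∷ (p₃₄ ∷ _) ∷ (p₄₅ ∷ _) ∷ _) C⇔l =
    ⊥-elim (five-points-impossible spread-free p₁₂ p₂₃ p₃₄ p₄₅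
      (in-C (here refl)) (in-C (there (here refl))) (in-C (there (there (here refl))))
      (in-C (there (there (there (here refl)))))
      (in-C (there (there (there (there (here refl)))))))
    where
    in-C : ∀ {e} → e ∈ l → InC σ e
    in-C {e} = from (C⇔l e)

module _ {k : ℕ} where

  φ-total : (σ : VSet k) → InX3 σ → Σ (ChainA k) (φFib σ)
  φ-total σ x3 with inX1? σ x3
  ... | yes x1 = a₀ , inj₁ x1
  ... | no ¬x1 = Classification.classify-sorted x3 ¬x1 (complement-list σ)
                   (complement-list-sorted σ) (complement-list-complete σ)

  -- (i) φ is order preserving: an inclusion σ ⊆ τ gives C_τ ⊆ C_σ, so
  -- P_{t,j} ∋ σ forbids τ ∈ X_2, and forces τ ∈ P_{t,j′} (same t).
  φ-monotone : (σ τ : VSet k) (x y : ChainA k) → InX3 σ → σ ⊆ τ →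
               φFib σ x → φFib τ y → x ≤A y
  φ-monotone σ τ a₀ y _ _ _ _ = tt
  φ-monotone σ τ (aᵢ t) a₀ x3 σ⊆τ (_ , _ , _ , ¬x2 , _) (inj₁ x1) =
    ⊥-elim (¬x2 (inj₁ (X1-downward σ⊆τ (proj₁ x3) x1)))
  φ-monotone σ τ (aᵢ t) a₀ _ σ⊆τ (_ , _ , _ , _ , Cσ≈) (inj₂ (_ , _ , card4)) =
    ⊥-elim (no-card4-in-triple (λ e → to (Cσ≈ e) ∘ complement-antitone σ⊆τ e) card4)
  φ-monotone σ τ (aᵢ t) (aᵢ s) _ σ⊆τ (_ , j∈I , _ , _ , Cσ≈) (_ , j′∈I , _ , _ , Cτ≈) =
    ℕP.≤-reflexive (cong toℕ (consecutive-pair-unique j∈I j′∈I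
      (λ x → to (Cσ≈ x) ∘ complement-antitone σ⊆τ x ∘ from (Cτ≈ x))))

  -- (ii) φ_i is order preserving: C_τ = {i, i+1, j′} ⊆ C_σ = {i, i+1, j}
  -- forces j′ = j.
  φᵢ-monotone : (i : El k) (σ τ : VSet k) (j j′ : El k) → InI i j′ →
                InP i j σ → InP i j′ τ → σ ⊆ τ → j ≤C[ i ] j′
  φᵢ-monotone i σ τ j j′ (_ , j′≢i , j′≢i+1) (_ , _ , Cσ≈) (_ , _ , Cτ≈) σ⊆τ
    with to (Cσ≈ j′) (complement-antitone σ⊆τ j′ (from (Cτ≈ j′) (inj₂ (inj₂ refl))))
  ... | inj₁ j′≡i = ⊥-elim (j′≢i j′≡i)
  ... | inj₂ (inj₁ j′≡i+1) = ⊥-elim (j′≢i+1 j′≡i+1)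
  ... | inj₂ (inj₂ j′≡j) = ℕP.≤-reflexive (cong (cdist i) j′≡j)

  unstable-member? : (σ : VSet k) (v : Vertex k) → Dec (Unstable v × v ∈s σ)
  unstable-member? σ v = unstable? v ×-dec (σ v ≟B true)

  -- (iii) φ_{i,j} is total: σ ∉ X_1 has an unstable vertex, hence a least one.
  φᵢⱼ-total : (σ : VSet k) → InX3 σ → ¬ InX1 σ → ∃ (BFib σ)
  φᵢⱼ-total σ x3 ¬x1 with any-vertex? (unstable-member? σ)
  ... | no none = ⊥-elim (¬x1 (all-stable⇒X1 x3 (λ α α∈σ α-unstable → none (α , α-unstable , α∈σ))))
  ... | yes (_ , unstable-member) with lex-least _ (unstable-member? σ) unstable-member
  ...   | m , (m-unstable , m∈σ) , least =
    m , m-unstable , m∈σ , λ w w-unstable w<m w∈σ → least w (w-unstable , w∈σ) w<m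

  -- (iii) φ_{i,j} is order preserving: the least unstable vertex of τ is at
  -- most any unstable vertex of σ ⊆ τ.
  φᵢⱼ-monotone : (σ τ : VSet k) (v w : Vertex k) → σ ⊆ τ → BFib σ v → BFib τ w → w ≤lex v
  φᵢⱼ-monotone σ τ v w σ⊆τ (v-unstable , v∈σ , _) (_ , _ , w-least) =
    ¬<lex⇒≥lex v w (λ v<w → w-least v v-unstable v<w (σ⊆τ v v∈σ))

lemma4p2 : (k : ℕ) →
  -- (i) φ is a well-defined (total) map on P_3 and order-preserving
  ( (∀ (σ : VSet k) → InX3 σ → Σ (ChainA k) (φFib σ))
  × (∀ (σ τ : VSet k) (x y : ChainA k) → InX3 σ → InX3 τ → σ ⊆ τ →
       φFib σ x → φFib τ y → x ≤A y) )
  × (∀ (i : El k) →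
    -- (ii) φ_i is order-preserving (its fibres are the P_{i,j})
    (∀ (σ τ : VSet k) (j j' : El k) → InI i j → InI i j' →
       InP i j σ → InP i j' τ → σ ⊆ τ → j ≤C[ i ] j')
    -- (iii) each φ_{i,j} is a well-defined (total) order-preserving map;
    -- b_v ≤ b_w iff w ≤lex v
    × (∀ (j : El k) → InI i j →
        (∀ (σ : VSet k) → InP i j σ → ∃ λ v → BFib σ v)
        × (∀ (σ τ : VSet k) (v w : Vertex k) → InP i j σ → InP i j τ →
             σ ⊆ τ → BFib σ v → BFib τ w → w ≤lex v)))
lemma4p2 k =
  ( φ-total
  , λ σ τ x y x3 _ → φ-monotone σ τ x y x3 )
  , λ i →
    ( (λ σ τ j j′ _ j′∈I → φᵢ-monotone i σ τ j j′ j′∈I)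
    , λ j _ →
      ( (λ σ (x3 , ¬x2 , _) → φᵢⱼ-total σ x3 (¬x2 ∘ inj₁))
      , λ σ τ v w _ _ → φᵢⱼ-monotone σ τ v w ) )
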